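{- Let $AP$ be a set of atomic propositions. For every infinite word $u \in (2^{AP})^{\omega}$, every $n \in \mathbb{N}$ and every $\mathrm{LTL}^{\leq}$ formula $\phi$, we have $u \vdash \phi[n]$ if and only if $[\![\phi]\!](u) \leq n$.
   Context: Notation: for $u \in (2^{AP})^{\omega}$ and $i \in \mathbb{N}$, $u_i$ is the $i$-th letter of $u$ and $u^i$ is the suffix of $u$ starting at $u_i$ (so $u^0=u$). $\mathrm{LTL}^{\leq}$ formulae are given by the grammar ($a \in AP$): $\phi ::= a \mid \neg a \mid \phi \vee \phi \mid \phi \wedge \phi \mid \phi\, \mathbf{U}\, \phi \mid \phi\, \mathbf{R}\, \phi \mid \mathbf{X}\phi \mid \phi\, \mathbf{U}^{\leq} \phi$. Formulae without $\mathbf{U}^{\leq}$ form the fragment $\mathrm{LTL}$ (LTL in negation normal form); for an LTL formula $\psi$, $u \vdash \psi$ denotes the usual LTL satisfaction of $\psi$ by $u$. $\top$ and $\bot$ denote true and false. Semantics: for $u\in(2^{AP})^\omega$, $n \in \mathbb{N}$: $(u,n)\models a$ iff $a \in u_0$; $(u,n)\models \neg a$ iff $a\notin u_0$; $\vee,\wedge$ as usual; $(u,n)\models \mathbf{X}\phi_1$ iff $(u^1,n)\models\phi_1$; $(u,n)\models \phi_1\mathbf{U}\phi_2$ iff there is $i$ with $(u^i,n)\models\phi_2$ and $(u^j,n)\models\phi_1$ for all $j<i$; $(u,n)\models\phi_1\mathbf{R}\phi_2$ iff for all $i$, either $(u^i,n)\models\phi_2$ or there is $j<i$ with $(u^j,n)\models\phi_1$;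 $(u,n)\models\phi_1\mathbf{U}^{\leq}\phi_2$ iff there is $i$ with $(u^i,n)\models\phi_2$ and $|\{j<i \mid (u^j,n)\not\models\phi_1\}|\leq n$. The value is $[\![\phi]\!](u) = \inf\{n \mid (u,n)\models\phi\} \in \mathbb{N}\cup\{\infty\}$, with $\inf\emptyset=\infty$. The LTL formula $\phi[n]$ is defined inductively: $a[n]=a$, $(\neg a)[n]=\neg a$; $(\mathbf{X}\phi_1)[n]=\mathbf{X}(\phi_1[n])$; $(\phi_1\bowtie\phi_2)[n]=\phi_1[n]\bowtie\phi_2[n]$ for $\bowtie\in\{\vee,\wedge,\mathbf{U},\mathbf{R}\}$; if $\phi_1,\phi_2$ are LTL formulae, $(\phi_1\mathbf{U}^{\leq}\phi_2)[0]=\phi_1\mathbf{U}\phi_2$ and $(\phi_1\mathbf{U}^{\leq}\phi_2)[n+1]=(\phi_1\vee\mathbf{X}((\phi_1\mathbf{U}^{\leq}\phi_2)[n]))\,\mathbf{U}\,\phi_2$; otherwise $(\phi_1\mathbf{U}^{\leq}\phi_2)[n]=(\phi_1[n]\,\mathbf{U}^{\leq}\,\phi_2[n])[n]$. -}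

module Defs where

open import Data.Nat using (ℕ; zero; suc; _+_; _≤_; _<_)
open import Data.Product using (Σ; ∃; _×_; _,_)
open import Data.Sum using (_⊎_)
open import Data.Fin using (Fin; toℕ)
open import Data.Fin.Subset using (Subset; _∉_; ∣_∣)
open import Data.Maybe using (Maybe; just; nothing)
open import Relation.Nullary using (¬_)

-- A letter of (2^AP) is a subset of AP (a predicate on AP);
-- an infinite word is an ω-sequence of letters.
Letter : Set → Set₁
Letter AP = AP → Set

Word : Set → Set₁
Word AP = ℕ → Letter AP

suffix : {AP : Set} → Word AP → ℕ → Word AP
suffix u i = λ k → u (i + k)

data LTL (AP : Set) : Set where
  atom  : AP → LTL AP
  natom : AP → LTL AP
  _∨_   : LTL AP → LTL AP → LTL AP
  _∧_   : LTL AP → LTL AP → LTL AP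
  _U_   : LTL AP → LTL AP → LTL AP
  _R_   : LTL AP → LTL AP → LTL AP
  X     : LTL AP → LTL AP

data LTL≤ (AP : Set) : Set where
  atom  : AP → LTL≤ AP
  natom : AP → LTL≤ AP
  _∨_   : LTL≤ AP → LTL≤ AP → LTL≤ AP
  _∧_   : LTL≤ AP → LTL≤ AP → LTL≤ AP
  _U_   : LTL≤ AP → LTL≤ AP → LTL≤ AP
  _R_   : LTL≤ AP → LTL≤ AP → LTL≤ AP
  X     : LTL≤ AP → LTL≤ AP
  _U≤_  : LTL≤ AP → LTL≤ AP → LTL≤ AP

_⊢_ : {AP : Set} → Word AP → LTL AP → Set
u ⊢ atom a  = u 0 a
u ⊢ natom a = ¬ u 0 a
u ⊢ (ψ₁ ∨ ψ₂) = (u ⊢ ψ₁) ⊎ (u ⊢ ψ₂)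
u ⊢ (ψ₁ ∧ ψ₂) = (u ⊢ ψ₁) × (u ⊢ ψ₂)
u ⊢ (ψ₁ U ψ₂) = Σ ℕ λ i → (suffix u i ⊢ ψ₂) × (∀ j → j < i → suffix u j ⊢ ψ₁)
u ⊢ (ψ₁ R ψ₂) = ∀ i → (suffix u i ⊢ ψ₂) ⊎ (Σ ℕ λ j → j < i × (suffix u j ⊢ ψ₁))
u ⊢ X ψ = suffix u 1 ⊢ ψ

-- (u , n) ⊨ φ
-- For U≤: |{ j < i | (u^j,n) ⊭ φ₁ }| ≤ n is expressed as: there is a subset S of
-- {0,…,i-1} with |S| ≤ n containing every j < i with (u^j,n) ⊭ φ₁
-- (i.e. every j < i outside S satisfies φ₁).
Sat : {AP : Set} → Word AP → ℕ → LTL≤ AP → Set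
Sat u n (atom a)  = u 0 a
Sat u n (natom a) = ¬ u 0 a
Sat u n (φ₁ ∨ φ₂) = Sat u n φ₁ ⊎ Sat u n φ₂
Sat u n (φ₁ ∧ φ₂) = Sat u n φ₁ × Sat u n φ₂
Sat u n (φ₁ U φ₂) = Σ ℕ λ i → Sat (suffix u i) n φ₂ × (∀ j → j < i → Sat (suffix u j) n φ₁)
Sat u n (φ₁ R φ₂) = ∀ i → Sat (suffix u i) n φ₂ ⊎ (Σ ℕ λ j → j < i × Sat (suffix u j) n φ₁)
Sat u n (X φ) = Sat (suffix u 1) n φ
Sat u n (φ₁ U≤ φ₂) =
  Σ ℕ λ i → Sat (suffix u i) n φ₂ ×
    (Σ (Subset i) λ S → ∣ S ∣ ≤ n × (∀ (j : Fin i) → j ∉ S → Sat (suffix u (toℕ j)) n φ₁))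

-- [[φ]](u) ≤ n, where [[φ]](u) = inf { m | (u,m) ⊨ φ } ∈ ℕ ∪ {∞}.
-- Since the infimum of a subset of ℕ is attained when the subset is non-empty
-- (and is ∞ otherwise), inf S ≤ n holds iff some m ≤ n lies in S.
ValueLe : {AP : Set} → LTL≤ AP → Word AP → ℕ → Set
ValueLe φ u n = Σ ℕ λ m → m ≤ n × Sat u m φ

toLTL : {AP : Set} → LTL≤ AP → Maybe (LTL AP)
toLTL (atom a)  = just (atom a)
toLTL (natom a) = just (natom a)
toLTL (φ₁ ∨ φ₂) with toLTL φ₁ | toLTL φ₂
... | just ψ₁ | just ψ₂ = just (ψ₁ ∨ ψ₂)
... | _ | _ = nothing
toLTL (φ₁ ∧ φ₂) with toLTL φ₁ | toLTL φ₂
... | just ψ₁ | just ψ₂ = just (ψ₁ ∧ ψ₂)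
... | _ | _ = nothing
toLTL (φ₁ U φ₂) with toLTL φ₁ | toLTL φ₂
... | just ψ₁ | just ψ₂ = just (ψ₁ U ψ₂)
... | _ | _ = nothing
toLTL (φ₁ R φ₂) with toLTL φ₁ | toLTL φ₂
... | just ψ₁ | just ψ₂ = just (ψ₁ R ψ₂)
... | _ | _ = nothing
toLTL (X φ) with toLTL φ
... | just ψ = just (X ψ)
... | nothing = nothing
toLTL (φ₁ U≤ φ₂) = nothing

unfoldU≤ : {AP : Set} → LTL AP → LTL AP → ℕ → LTL AP
unfoldU≤ ψ₁ ψ₂ zero    = ψ₁ U ψ₂
unfoldU≤ ψ₁ ψ₂ (suc n) = (ψ₁ ∨ X (unfoldU≤ ψ₁ ψ₂ n)) U ψ₂

_[_] : {AP : Set} → LTL≤ AP → ℕ → LTL AP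
atom a    [ n ] = atom a
natom a   [ n ] = natom a
(φ₁ ∨ φ₂) [ n ] = (φ₁ [ n ]) ∨ (φ₂ [ n ])
(φ₁ ∧ φ₂) [ n ] = (φ₁ [ n ]) ∧ (φ₂ [ n ])
(φ₁ U φ₂) [ n ] = (φ₁ [ n ]) U (φ₂ [ n ])
(φ₁ R φ₂) [ n ] = (φ₁ [ n ]) R (φ₂ [ n ])
X φ       [ n ] = X (φ [ n ])
(φ₁ U≤ φ₂) [ n ] with toLTL φ₁ | toLTL φ₂
... | just ψ₁ | just ψ₂ = unfoldU≤ ψ₁ ψ₂ n
... | _ | _ = unfoldU≤ (φ₁ [ n ]) (φ₂ [ n ]) n

module Submission where

-- By induction on φ, (u , n) ⊨ φ iff u ⊢ φ[n]; as ⊨ is monotone in n, this is the claim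
-- about [[φ]](u).  The only real case is U≤: both its semantics (at most n positions
-- failing P before Q) and the unfolded formula (ψ₁ ∨ X(previous unfolding)) U ψ₂ are
-- equivalent to the inductive predicate Reaches, in which each failure of P spends one
-- unit of the budget n; the failing positions are those where the unfolding takes the
-- X branch.

open import Defs
open import Data.Nat using (ℕ; zero; suc; _≤_; _<_; z≤n; s≤s; z<s)
open import Data.Nat.Properties using (≤-trans; ≤-refl)
open import Data.Product using (_×_; Σ; ∃-syntax; _,_; proj₁; proj₂)
import Data.Product as Product
open import Data.Sum using (_⊎_; inj₁; inj₂)
import Data.Sum as Sum
open import Data.Bool using (true; false)
open import Data.Fin using (toℕ; zero; suc)
open import Data.Fin.Subset using (Subset; _∉_; ∣_∣)
open import Data.Fin.Subset.Properties using (drop-there)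
open import Data.Vec using ([]; _∷_; here; there)
open import Data.Maybe using (just; nothing)
open import Data.Empty using (⊥-elim)
open import Function using (_∘_; id)
open import Level using (Level; 0ℓ)
open import Relation.Binary.PropositionalEquality using (_≡_; refl)
open import Relation.Unary using (Pred; _⊆′_; _≐′_)

private variable
  ℓ : Level
  AP : Set
  P P′ Q Q′ : Pred (Word AP) 0ℓ
  u : Word AP
  m n : ℕ

Sat-mono : (φ : LTL≤ AP) → m ≤ n → Sat u m φ → Sat u n φ
Sat-mono (atom a) m≤n s = s
Sat-mono (natom a) m≤n s = s
Sat-mono (φ ∨ ψ) m≤n (inj₁ s) = inj₁ (Sat-mono φ m≤n s)
Sat-mono (φ ∨ ψ) m≤n (inj₂ s) = inj₂ (Sat-mono ψ m≤n s)
Sat-mono (φ ∧ ψ) m≤n (s , t) = Sat-mono φ m≤n s , Sat-mono ψ m≤n t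
Sat-mono (φ U ψ) m≤n (i , s , h) = i , Sat-mono ψ m≤n s , λ j j<i → Sat-mono φ m≤n (h j j<i)
Sat-mono (φ R ψ) m≤n h i =
  Sum.map (Sat-mono ψ m≤n) (Product.map₂ (Product.map₂ (Sat-mono φ m≤n))) (h i)
Sat-mono (X φ) m≤n s = Sat-mono φ m≤n s
Sat-mono (φ U≤ ψ) m≤n (i , s , S , ∣S∣≤m , h) =
  i , Sat-mono ψ m≤n s , S , ≤-trans ∣S∣≤m m≤n , λ j j∉S → Sat-mono φ m≤n (h j j∉S)

Until : Pred (Word AP) 0ℓ → Pred (Word AP) 0ℓ → Pred (Word AP) 0ℓ
Until P Q u = ∃[ i ] Q (suffix u i) × (∀ j → j < i → P (suffix u j))

Release : Pred (Word AP) 0ℓ → Pred (Word AP) 0ℓ → Pred (Word AP) 0ℓ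
Release P Q u = ∀ i → Q (suffix u i) ⊎ ∃[ j ] j < i × P (suffix u j)

Until-map : P ⊆′ P′ → Q ⊆′ Q′ → Until P Q ⊆′ Until P′ Q′
Until-map f g u (i , q , p) = i , g (suffix u i) q , λ j j<i → f (suffix u j) (p j j<i)

Release-map : P ⊆′ P′ → Q ⊆′ Q′ → Release P Q ⊆′ Release P′ Q′
Release-map f g u r i =
  Sum.map (g (suffix u i)) (λ { (j , j<i , p) → j , j<i , f (suffix u j) p }) (r i)

module _ {AP : Set} {P Q : Pred (Word AP) 0ℓ} where

  Until-now : Q ⊆′ Until P Q
  Until-now _ q = 0 , q , λ _ ()

  Until-step : ∀ u → P u → Until P Q (suffix u 1) → Until P Q u
  Until-step _ p (i , q , h) = suc i , q , λ { zero _ → p ; (suc j) (s≤s j<i) → h j j<i }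

  Until-rec : (T : Pred (Word AP) ℓ) → Q ⊆′ T → (∀ u → P u → T (suffix u 1) → T u) →
    Until P Q ⊆′ T
  Until-rec T now step u (i , q , p) = go u i q p
    where
    go : ∀ u i → Q (suffix u i) → (∀ j → j < i → P (suffix u j)) → T u
    go u zero q p = now u q
    go u (suc i) q p = step u (p 0 z<s) (go (suffix u 1) i q λ j j<i → p (suc j) (s≤s j<i))

module _ {AP : Set} {P Q : Pred (Word AP) 0ℓ} where

  -- What (ψ₁ U≤ ψ₂)[n] and ψ₁ ∨ X((ψ₁ U≤ ψ₂)[n-1]) denote, with ψ₁, ψ₂ denoting P, Q;
  -- for n = 0 the retry disjunct is absent.
  Unfolding : ℕ → Pred (Word AP) 0ℓ
  Passable : ℕ → Pred (Word AP) 0ℓ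
  Unfolding n = Until (Passable n) Q
  Passable zero = P
  Passable (suc n) v = P v ⊎ Unfolding n (suffix v 1)

  Unfolding-mono : ∀ n → Unfolding n ⊆′ Unfolding (suc n)
  Passable-mono : ∀ n → Passable n ⊆′ Passable (suc n)
  Unfolding-mono n = Until-map {Q = Q} (Passable-mono n) (λ _ → id)
  Passable-mono zero _ = inj₁
  Passable-mono (suc n) v = Sum.map₂ (Unfolding-mono n (suffix v 1))

  Unfolding-now : ∀ n → Q ⊆′ Unfolding n
  Unfolding-now n = Until-now {P = Passable n} {Q = Q}

  Unfolding-pass : ∀ n u → P u → Unfolding n (suffix u 1) → Unfolding n u
  Unfolding-pass zero = Until-step {Q = Q}
  Unfolding-pass (suc n) u p = Until-step {P = Passable (suc n)} {Q = Q} u (inj₁ p)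

  Unfolding-retry : ∀ n u → Unfolding n (suffix u 1) → Unfolding (suc n) u
  Unfolding-retry n u r =
    Until-step {P = Passable (suc n)} {Q = Q} u (inj₂ r) (Unfolding-mono n (suffix u 1) r)

  module _ {ψ₁ ψ₂ : LTL AP} where

    Unfolding⊆⊢ : P ⊆′ (_⊢ ψ₁) → Q ⊆′ (_⊢ ψ₂) → ∀ n → Unfolding n ⊆′ (_⊢ unfoldU≤ ψ₁ ψ₂ n)
    Unfolding⊆⊢ f g zero = Until-map f g
    Unfolding⊆⊢ f g (suc n) =
      Until-map (λ v → Sum.map (f v) (Unfolding⊆⊢ f g n (suffix v 1))) g

    ⊢⊆Unfolding : (_⊢ ψ₁) ⊆′ P → (_⊢ ψ₂) ⊆′ Q → ∀ n → (_⊢ unfoldU≤ ψ₁ ψ₂ n) ⊆′ Unfolding n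
    ⊢⊆Unfolding f g zero = Until-map f g
    ⊢⊆Unfolding f g (suc n) =
      Until-map (λ v → Sum.map (f v) (⊢⊆Unfolding f g n (suffix v 1))) g

  Until≤ : ℕ → Pred (Word AP) 0ℓ
  Until≤ n u = ∃[ i ] Q (suffix u i) ×
    Σ (Subset i) λ S → ∣ S ∣ ≤ n × (∀ j → j ∉ S → P (suffix u (toℕ j)))

  data Reaches : ℕ → Word AP → Set₁ where
    now  : Q u → Reaches n u
    pass : P u → Reaches n (suffix u 1) → Reaches n u
    skip : Reaches n (suffix u 1) → Reaches (suc n) u

  Until≤⊆Reaches : ∀ n → Until≤ n ⊆′ Reaches n
  Until≤⊆Reaches n u (i , q , S , ∣S∣≤n , p) = go u i S q ∣S∣≤n p
    where
    go : ∀ {n} u i (S : Subset i) → Q (suffix u i) → ∣ S ∣ ≤ n →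
      (∀ j → j ∉ S → P (suffix u (toℕ j))) → Reaches n u
    go u zero [] q _ _ = now q
    go u (suc i) (false ∷ S) q ∣S∣≤n p =
      pass (p zero λ ())
           (go (suffix u 1) i S q ∣S∣≤n λ j j∉S → p (suc j) (j∉S ∘ drop-there))
    go u (suc i) (true ∷ S) q (s≤s ∣S∣≤n) p =
      skip (go (suffix u 1) i S q ∣S∣≤n λ j j∉S → p (suc j) (j∉S ∘ drop-there))

  Reaches⊆Until≤ : ∀ n → Reaches n ⊆′ Until≤ n
  Reaches⊆Until≤ n u (now q) = 0 , q , [] , z≤n , λ ()
  Reaches⊆Until≤ n u (pass p r) with Reaches⊆Until≤ n (suffix u 1) r
  ... | i , q , S , ∣S∣≤n , h = suc i , q , false ∷ S , ∣S∣≤n , λ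
    { zero _ → p
    ; (suc j) j∉S → h j (j∉S ∘ there) }
  Reaches⊆Until≤ (suc n) u (skip r) with Reaches⊆Until≤ n (suffix u 1) r
  ... | i , q , S , ∣S∣≤n , h = suc i , q , true ∷ S , s≤s ∣S∣≤n , λ
    { zero 0∉S → ⊥-elim (0∉S here)
    ; (suc j) j∉S → h j (j∉S ∘ there) }

  Reaches⊆Unfolding : ∀ n → Reaches n ⊆′ Unfolding n
  Reaches⊆Unfolding n u (now q) = Unfolding-now n u q
  Reaches⊆Unfolding n u (pass p r) = Unfolding-pass n u p (Reaches⊆Unfolding n (suffix u 1) r)
  Reaches⊆Unfolding (suc n) u (skip r) =
    Unfolding-retry n u (Reaches⊆Unfolding n (suffix u 1) r)

  Unfolding⊆Reaches : ∀ n → Unfolding n ⊆′ Reaches n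
  Unfolding⊆Reaches n = Until-rec {P = Passable n} {Q = Q} (Reaches n) (λ _ → now) (step n)
    where
    step : ∀ n u → Passable n u → Reaches n (suffix u 1) → Reaches n u
    step zero u p r = pass p r
    step (suc n) u (inj₁ p) r = pass p r
    step (suc n) u (inj₂ retry) _ = skip (Unfolding⊆Reaches n (suffix u 1) retry)

  Until≤≐Unfolding : ∀ n → Until≤ n ≐′ Unfolding n
  Until≤≐Unfolding n =
    (λ u → Reaches⊆Unfolding n u ∘ Until≤⊆Reaches n u) ,
    (λ u → Reaches⊆Until≤ n u ∘ Unfolding⊆Reaches n u)

toLTL-[] : (φ : LTL≤ AP) (n : ℕ) {ψ : LTL AP} → toLTL φ ≡ just ψ → φ [ n ] ≡ ψ
toLTL-[] (atom a) n refl = refl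
toLTL-[] (natom a) n refl = refl
toLTL-[] (φ₁ ∨ φ₂) n e with toLTL φ₁ in e₁ | toLTL φ₂ in e₂
toLTL-[] (φ₁ ∨ φ₂) n refl | just _ | just _ rewrite toLTL-[] φ₁ n e₁ | toLTL-[] φ₂ n e₂ = refl
toLTL-[] (φ₁ ∧ φ₂) n e with toLTL φ₁ in e₁ | toLTL φ₂ in e₂
toLTL-[] (φ₁ ∧ φ₂) n refl | just _ | just _ rewrite toLTL-[] φ₁ n e₁ | toLTL-[] φ₂ n e₂ = refl
toLTL-[] (φ₁ U φ₂) n e with toLTL φ₁ in e₁ | toLTL φ₂ in e₂
toLTL-[] (φ₁ U φ₂) n refl | just _ | just _ rewrite toLTL-[] φ₁ n e₁ | toLTL-[] φ₂ n e₂ = refl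
toLTL-[] (φ₁ R φ₂) n e with toLTL φ₁ in e₁ | toLTL φ₂ in e₂
toLTL-[] (φ₁ R φ₂) n refl | just _ | just _ rewrite toLTL-[] φ₁ n e₁ | toLTL-[] φ₂ n e₂ = refl
toLTL-[] (X φ) n e with toLTL φ in e₁
toLTL-[] (X φ) n refl | just _ rewrite toLTL-[] φ n e₁ = refl

[]-U≤ : (φ₁ φ₂ : LTL≤ AP) (n : ℕ) → (φ₁ U≤ φ₂) [ n ] ≡ unfoldU≤ (φ₁ [ n ]) (φ₂ [ n ]) n
[]-U≤ φ₁ φ₂ n with toLTL φ₁ in e₁ | toLTL φ₂ in e₂
... | just _ | just _ rewrite toLTL-[] φ₁ n e₁ | toLTL-[] φ₂ n e₂ = refl
... | just _ | nothing = refl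
... | nothing | just _ = refl
... | nothing | nothing = refl

Sat≐⊢ : (φ : LTL≤ AP) (n : ℕ) → (λ u → Sat u n φ) ≐′ (_⊢ (φ [ n ]))
Sat≐⊢ (atom a) n = (λ _ → id) , (λ _ → id)
Sat≐⊢ (natom a) n = (λ _ → id) , (λ _ → id)
Sat≐⊢ (φ₁ ∨ φ₂) n with Sat≐⊢ φ₁ n | Sat≐⊢ φ₂ n
... | to₁ , from₁ | to₂ , from₂ =
  (λ u → Sum.map (to₁ u) (to₂ u)) , (λ u → Sum.map (from₁ u) (from₂ u))
Sat≐⊢ (φ₁ ∧ φ₂) n with Sat≐⊢ φ₁ n | Sat≐⊢ φ₂ n
... | to₁ , from₁ | to₂ , from₂ =
  (λ u → Product.map (to₁ u) (to₂ u)) , (λ u → Product.map (from₁ u) (from₂ u))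
Sat≐⊢ (φ₁ U φ₂) n with Sat≐⊢ φ₁ n | Sat≐⊢ φ₂ n
... | to₁ , from₁ | to₂ , from₂ = Until-map to₁ to₂ , Until-map from₁ from₂
Sat≐⊢ (φ₁ R φ₂) n with Sat≐⊢ φ₁ n | Sat≐⊢ φ₂ n
... | to₁ , from₁ | to₂ , from₂ = Release-map to₁ to₂ , Release-map from₁ from₂
Sat≐⊢ (X φ) n with Sat≐⊢ φ n
... | to , from = (λ u → to (suffix u 1)) , (λ u → from (suffix u 1))
Sat≐⊢ (φ₁ U≤ φ₂) n with Sat≐⊢ φ₁ n | Sat≐⊢ φ₂ n
... | to₁ , from₁ | to₂ , from₂ rewrite []-U≤ φ₁ φ₂ n =
  (λ u → Unfolding⊆⊢ to₁ to₂ n u ∘ proj₁ (Until≤≐Unfolding n) u) ,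
  (λ u → proj₂ (Until≤≐Unfolding n) u ∘ ⊢⊆Unfolding from₁ from₂ n u)

proposition1 : {AP : Set} (u : Word AP) (n : ℕ) (φ : LTL≤ AP) →
    ((u ⊢ (φ [ n ])) → ValueLe φ u n) × (ValueLe φ u n → (u ⊢ (φ [ n ])))
proposition1 u n φ =
  (λ u⊢φ[n] → n , ≤-refl , proj₂ (Sat≐⊢ φ n) u u⊢φ[n]) ,
  (λ { (m , m≤n , sat) → proj₁ (Sat≐⊢ φ n) u (Sat-mono φ m≤n sat) })
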